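{- Let $\mathcal{R}$ be a DCTRS and let $u_0 \rightarrow_{p_0} u_1 \rightarrow_{p_1} \cdots \rightarrow_{p_{n-1}} u_n$ be an innermost derivation in $\mathbb{U}_{seq}(\mathcal{R})$ with $u_0 \in \mathcal{T}$. Then there is an innermost, almost U-eager derivation $u_0 \rightarrow^*_{\mathbb{U}_{seq}(\mathcal{R})} u_n$.
   Context: Terms $\mathcal{T}=\mathcal{T}(\mathcal{F},\mathcal{V})$ over a signature $\mathcal{F}$ and a countably infinite set of variables $\mathcal{V}$. An (oriented) conditional rule has the form $l \rightarrow r \Leftarrow s_1 \rightarrow^* t_1, \ldots, s_k \rightarrow^* t_k$ ($k\ge 0$). It is deterministic if $\mathcal{V}ar(r) \subseteq \mathcal{V}ar(l) \cup \mathcal{V}ar(s_1,t_1,\ldots,s_k,t_k)$ and $\mathcal{V}ar(s_i) \subseteq \mathcal{V}ar(l, t_1, \ldots, t_{i-1})$ for all $i$. A DCTRS $\mathcal{R}$ is a set of such rules. Sequential unraveling: for $\alpha: l \rightarrow r \Leftarrow s_1 \rightarrow^* t_1, \ldots, s_k \rightarrow^* t_k$ with $k\ge1$, let $X_i=\mathcal{V}ar(l,t_1,\ldots,t_{i-1})$ with fixed ordering $\vec{X_i}$, fresh symbols $U^\alpha_1,\dots,U^\alpha_k$, and $\mathbb{U}_{seq}(\alpha)=\{l \rightarrow U^\alpha_1(s_1,\vec{X_1})\}\cup\{U^\alpha_i(t_i,\vec{X_i}) \rightarrow U^\alpha_{i+1}(s_{i+1},\vec{X_{i+1}}) \mid 1\le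 i<k\}\cup\{U^\alpha_k(t_k,\vec{X_k}) \rightarrow r\}$; unconditional rules are kept unchanged. $\mathbb{U}_{seq}(\mathcal{R})=\bigcup_{\alpha}\mathbb{U}_{seq}(\alpha)$; a U-term is a term whose root is some $U^\alpha_i$. A derivation is innermost if each step contracts a redex no proper subterm of which is a redex. Positions: $q \le p$ means $p$ is below or equal to $q$. $u \rightarrow_{p} v$ is a rewrite step at position $p$. A derivation $u_0 \rightarrow_{p_0} u_1 \rightarrow_{p_1} \cdots \rightarrow_{p_{n-1}} u_n$ in $\mathbb{U}_{seq}(\mathcal{R})$ is almost U-eager if for every step $u_i \rightarrow_{p_i} u_{i+1}$ ($i \in \{1,\ldots,n-1\}$): if there is a U-term $u_i|_q$ with $q \le p_i$, then also $q \le p_{i-1}$. -}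

module Defs where

open import Data.Nat using (ℕ; zero; suc; _<_; _≟_)
open import Data.Fin using (Fin; toℕ)
open import Data.List using (List; []; _∷_; _++_; length; concatMap; take; lookup; deduplicate)
open import Data.List.Membership.Propositional using (_∈_)
open import Data.Vec using (Vec; []; _∷_; fromList)
import Data.Vec as V
open import Data.Maybe using (Maybe; just; nothing)
open import Data.Product using (Σ; ∃; ∃-syntax; _×_; _,_; proj₁; proj₂)
open import Data.Sum using (_⊎_; inj₁; inj₂)
open import Data.Unit using (⊤)
open import Data.Empty using (⊥)
open import Relation.Nullary using (¬_)
open import Relation.Binary.PropositionalEquality using (_≡_)
open import Function using (_∘_)

data Term {F : Set} (ar : F → ℕ) : Set where
  var : ℕ → Term ar
  fun : (f : F) → Vec (Term ar) (ar f) → Term ar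

-- Positions: sequences of (0-based) argument indices; [] is the root.
Pos : Set
Pos = List ℕ

-- q ≼ p  ("q ≤ p" in the paper): p is below or equal to q.
_≼_ : Pos → Pos → Set
q ≼ p = ∃[ r ] (q ++ r ≡ p)

module _ {F : Set} {ar : F → ℕ} where

  mutual
    vars : Term ar → List ℕ
    vars (var x) = x ∷ []
    vars (fun f ts) = varsArgs ts

    varsArgs : ∀ {n} → Vec (Term ar) n → List ℕ
    varsArgs [] = []
    varsArgs (t ∷ ts) = vars t ++ varsArgs ts

  mutual
    _⋅_ : Term ar → (ℕ → Term ar) → Term ar
    var x ⋅ σ = σ x
    fun f ts ⋅ σ = fun f (substArgs ts σ)

    substArgs : ∀ {n} → Vec (Term ar) n → (ℕ → Term ar) → Vec (Term ar) n
    substArgs [] σ = []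
    substArgs (t ∷ ts) σ = (t ⋅ σ) ∷ substArgs ts σ

  mutual
    _∣_ : Term ar → Pos → Maybe (Term ar)
    t ∣ [] = just t
    var x ∣ (i ∷ p) = nothing
    fun f ts ∣ (i ∷ p) = subArgs ts i p

    subArgs : ∀ {n} → Vec (Term ar) n → ℕ → Pos → Maybe (Term ar)
    subArgs [] i p = nothing
    subArgs (t ∷ ts) zero p = t ∣ p
    subArgs (t ∷ ts) (suc i) p = subArgs ts i p

  -- replacement u[v]_p (u unchanged if p is not a position of u)
  mutual
    replace : Term ar → Pos → Term ar → Term ar
    replace u [] v = v
    replace (var x) (i ∷ p) v = var x
    replace (fun f ts) (i ∷ p) v = fun f (replaceArgs ts i p v)

    replaceArgs : ∀ {n} → Vec (Term ar) n → ℕ → Pos → Term ar → Vec (Term ar) n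
    replaceArgs [] i p v = []
    replaceArgs (t ∷ ts) zero p v = replace t p v ∷ ts
    replaceArgs (t ∷ ts) (suc i) p v = t ∷ replaceArgs ts i p v

-- Oriented conditional rules  l → r ⇐ s₁ →* t₁, …, s_k →* t_k

record CRule {F : Set} (ar : F → ℕ) : Set where
  constructor _⟶_⇐_
  field
    lhs   : Term ar
    rhs   : Term ar
    conds : List (Term ar × Term ar)
open CRule public

module _ {F : Set} {ar : F → ℕ} where

  varsLT : CRule ar → ℕ → List ℕ
  varsLT ρ j = vars (lhs ρ) ++ concatMap (vars ∘ proj₂) (take j (conds ρ))

  condVars : CRule ar → List ℕ
  condVars ρ = concatMap (λ c → vars (proj₁ c) ++ vars (proj₂ c)) (conds ρ)

  -- deterministic rule (condition index j is 0-based: j stands for s_{j+1})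
  Deterministic : CRule ar → Set
  Deterministic ρ =
    (∀ x → x ∈ vars (rhs ρ) → x ∈ vars (lhs ρ) ⊎ x ∈ condVars ρ)
    × (∀ (j : Fin (length (conds ρ))) x →
         x ∈ vars (proj₁ (lookup (conds ρ) j)) → x ∈ varsLT ρ (toℕ j))

DCTRS : {F : Set} {ar : F → ℕ} {I : Set} → (I → CRule ar) → Set
DCTRS {I = I} R = ∀ (α : I) → Deterministic (R α)

module Unravel {F : Set} (arF : F → ℕ) {I : Set} (R : I → CRule arF) where

  k : I → ℕ
  k α = length (conds (R α))

  -- (0-based) j-th condition s_{j+1} →* t_{j+1}
  s t : (α : I) → Fin (k α) → Term arF
  s α j = proj₁ (lookup (conds (R α)) j)
  t α j = proj₂ (lookup (conds (R α)) j)

  -- the fixed ordering X⃗ of X_{j+1} = Var(l, t₁, …, t_j):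
  -- order of first occurrence, without duplicates
  X : (α : I) → Fin (k α) → List ℕ
  X α j = deduplicate _≟_ (varsLT (R α) (toℕ j))

  -- extended signature: F plus fresh symbols U^α_{j+1} for j : Fin (k α)
  Sym : Set
  Sym = F ⊎ Σ I (λ α → Fin (k α))

  ar : Sym → ℕ
  ar (inj₁ f) = arF f
  ar (inj₂ (α , j)) = suc (length (X α j))

  T : Set
  T = Term ar

  mutual
    lift : Term arF → T
    lift (var x) = var x
    lift (fun f ts) = fun (inj₁ f) (liftArgs ts)

    liftArgs : ∀ {n} → Vec (Term arF) n → Vec T n
    liftArgs [] = []
    liftArgs (u ∷ us) = lift u ∷ liftArgs us

  Uterm : (α : I) (j : Fin (k α)) → T → T
  Uterm α j a = fun (inj₂ (α , j)) (a ∷ V.map var (fromList (X α j)))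

  data UseqRule : T → T → Set where
    uncond : (α : I) → conds (R α) ≡ [] →
             UseqRule (lift (lhs (R α))) (lift (rhs (R α)))
    first  : (α : I) (j : Fin (k α)) → toℕ j ≡ 0 →
             UseqRule (lift (lhs (R α))) (Uterm α j (lift (s α j)))
    middle : (α : I) (j j′ : Fin (k α)) → toℕ j′ ≡ suc (toℕ j) →
             UseqRule (Uterm α j (lift (t α j))) (Uterm α j′ (lift (s α j′)))
    last   : (α : I) (j : Fin (k α)) → suc (toℕ j) ≡ k α →
             UseqRule (Uterm α j (lift (t α j))) (lift (rhs (R α)))

  IsUTerm : T → Set
  IsUTerm (var x) = ⊥
  IsUTerm (fun (inj₁ f) ts) = ⊥
  IsUTerm (fun (inj₂ _) ts) = ⊤

  Redex : T → Set
  Redex w = ∃[ l ] ∃[ r ] ∃[ σ ] (UseqRule l r × w ≡ l ⋅ σ)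

  Step : T → Pos → T → Set
  Step u p v = ∃[ l ] ∃[ r ] ∃[ σ ]
    (UseqRule l r × u ∣ p ≡ just (l ⋅ σ) × v ≡ replace u p (r ⋅ σ))

  InnermostStep : T → Pos → T → Set
  InnermostStep u p v = Step u p v ×
    (∀ w → u ∣ p ≡ just w → ∀ q w′ → ¬ (q ≡ []) → w ∣ q ≡ just w′ → ¬ Redex w′)

  -- u₀ →_{p₀} u₁ → ⋯ →_{p_{n-1}} u_n, given by us 0 … us n and ps 0 … ps (n-1)
  InnermostDeriv : ℕ → (ℕ → T) → (ℕ → Pos) → Set
  InnermostDeriv n us ps = ∀ i → i < n → InnermostStep (us i) (ps i) (us (suc i))

  -- almost U-eager: for every step i ∈ {1,…,n-1} (written i = suc j)
  AlmostUEager : ℕ → (ℕ → T) → (ℕ → Pos) → Set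
  AlmostUEager n us ps = ∀ j → suc j < n → ∀ q w →
    us (suc j) ∣ q ≡ just w → IsUTerm w → q ≼ ps (suc j) → q ≼ ps j

-- The steps are reordered greedily.  Call a U-term of the current term pending if some
-- remaining step rewrites at or below it before any step above it.  We keep the invariant
-- that every pending U-term lies above the position f of the step just performed, so the
-- pending U-terms form a chain.  The next step is the first one touching the deepest pending
-- U-term (or simply the first step if none is pending): the steps before it are parallel to
-- it and commute past it, and every U-term above it lies above f, which is almost U-eagerness.
-- The invariant survives the step because a U-term created strictly inside an innermost
-- contractum rσ is a normal form: the right-hand sides of U_seq(R) carry U-symbols only at
-- the root and, by determinism, only variables of the left-hand side, so such a U-term lies
-- inside some σ x, i.e. strictly inside the innermost redex lσ.  Initially u₀ ∈ T(F,V) has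
-- no U-terms at all.

module Submission where

open import Defs
open import Data.Nat using (ℕ; zero; suc; _<_; _≤_; s≤s; z≤n) renaming (_≟_ to _≟ℕ_)
open import Data.Nat.Properties using (m<1+n⇒m<n∨m≡n; <⇒≤; <-≤-trans; suc-injective)
open import Data.Fin using (Fin; toℕ)
import Data.Fin as Fin
open import Data.Fin.Properties using (toℕ-injective; toℕ<n)
open import Data.List using (List; []; _∷_; _++_; length; concatMap; take; lookup)
open import Data.List.Properties using (++-assoc; ++-identityʳ; length-++-sucʳ)
open import Data.List.Membership.Propositional using (_∈_)
open import Data.List.Membership.Propositional.Properties
  using (∈-++⁺ˡ; ∈-++⁺ʳ; ∈-++⁻; ∈-deduplicate⁻; ∈-deduplicate⁺; ∈-concatMap⁻)
open import Data.List.Relation.Unary.Any using (here; index)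
open import Data.List.Relation.Unary.Any.Properties using (lookup-index)
open import Data.List.Relation.Unary.All using (All; []; _∷_)
import Data.List.Relation.Unary.All as All
open import Data.Vec using (Vec; []; _∷_; fromList)
import Data.Vec as V
open import Data.Maybe using (just; nothing)
open import Data.Product using (Σ; ∃-syntax; _×_; _,_; proj₁; proj₂)
open import Data.Sum using (_⊎_; inj₁; inj₂; [_,_])
import Data.Sum as Sum
open import Data.Unit using (⊤; tt)
open import Data.Empty using (⊥; ⊥-elim)
open import Relation.Nullary using (¬_; Dec; yes; no)
open import Relation.Nullary.Decidable using (_×-dec_)
open import Relation.Binary.PropositionalEquality using (_≡_; refl; sym; trans; cong; cong₂; subst)
open import Function using (_∘_; id)

-- Positions

_∥_ : Pos → Pos → Set
q ∥ p = ¬ (q ≼ p) × ¬ (p ≼ q)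

∥-sym : ∀ {q p} → q ∥ p → p ∥ q
∥-sym (q⋠p , p⋠q) = p⋠q , q⋠p

≼-refl : ∀ {q} → q ≼ q
≼-refl {q} = [] , ++-identityʳ q

≼-trans : ∀ {a b c} → a ≼ b → b ≼ c → a ≼ c
≼-trans {a} (r , refl) (s , refl) = r ++ s , sym (++-assoc a r s)

≼-++ : ∀ q r → q ≼ (q ++ r)
≼-++ q r = r , refl

[]-≼ : ∀ p → [] ≼ p
[]-≼ p = p , refl

≼-[] : ∀ {q} → q ≼ [] → q ≡ []
≼-[] {[]} _ = refl
≼-[] {i ∷ q} (r , ())

∷-≼ : ∀ {i q p} → q ≼ p → (i ∷ q) ≼ (i ∷ p)
∷-≼ (r , refl) = r , refl

∷-≼⁻ : ∀ {i j q p} → (i ∷ q) ≼ (j ∷ p) → i ≡ j × q ≼ p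
∷-≼⁻ (r , refl) = refl , (r , refl)

≼-∷⁻ : ∀ {q i p} → q ≼ (i ∷ p) → q ≡ [] ⊎ ∃[ q′ ] (q ≡ i ∷ q′ × q′ ≼ p)
≼-∷⁻ {[]} _ = inj₁ refl
≼-∷⁻ {j ∷ q} (r , refl) = inj₂ (q , refl , (r , refl))

∷-∥ : ∀ {i q p} → (i ∷ q) ∥ (i ∷ p) → q ∥ p
∷-∥ (q⋠p , p⋠q) = q⋠p ∘ ∷-≼ , p⋠q ∘ ∷-≼

_≼?_ : (q p : Pos) → Dec (q ≼ p)
[] ≼? p = yes ([]-≼ p)
(i ∷ q) ≼? [] = no λ { (r , ()) }
(i ∷ q) ≼? (j ∷ p) with i ≟ℕ j | q ≼? p
... | yes refl | yes q≼p = yes (∷-≼ q≼p)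
... | yes refl | no q⋠p = no (q⋠p ∘ proj₂ ∘ ∷-≼⁻)
... | no i≢j | _ = no (i≢j ∘ proj₁ ∘ ∷-≼⁻)

≼-comparable : ∀ {a b p} → a ≼ p → b ≼ p → a ≼ b ⊎ b ≼ a
≼-comparable {[]} {b} _ _ = inj₁ ([]-≼ b)
≼-comparable {i ∷ a} {[]} _ _ = inj₂ ([]-≼ _)
≼-comparable {i ∷ a} {j ∷ b} {[]} (r , ()) _
≼-comparable {i ∷ a} {j ∷ b} {k ∷ p} a≼p b≼p with ∷-≼⁻ a≼p | ∷-≼⁻ b≼p
... | refl , a≼p′ | refl , b≼p′ = Sum.map ∷-≼ ∷-≼ (≼-comparable a≼p′ b≼p′)

∥-++ : ∀ {q p} r → q ∥ p → (q ++ r) ∥ p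
∥-++ {q} r (q⋠p , p⋠q) =
  q⋠p ∘ ≼-trans (≼-++ q r) ,
  λ p≼qr → [ p⋠q , q⋠p ] (≼-comparable p≼qr (≼-++ q r))

∥-≼ : ∀ {a q p} → a ∥ q → q ≼ p → a ∥ p
∥-≼ a∥q (r , refl) = ∥-sym (∥-++ r (∥-sym a∥q))

⋠-≼⇒strictly-below : ∀ {q p} → ¬ (q ≼ p) → p ≼ q → ∃[ i ] ∃[ r ] (q ≡ p ++ i ∷ r)
⋠-≼⇒strictly-below {q} {p} q⋠p ([] , p≡q) =
  ⊥-elim (q⋠p ([] , trans (++-identityʳ q) (trans (sym p≡q) (++-identityʳ p))))
⋠-≼⇒strictly-below _ (i ∷ r , refl) = i , r , refl

deepest-prefix : (f : Pos) (P : Pos → Set) → (∀ q → Dec (P q)) →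
  (∀ q → q ≼ f → ¬ P q) ⊎ ∃[ Q ] (Q ≼ f × P Q × (∀ q → q ≼ f → P q → q ≼ Q))
deepest-prefix [] P P? with P? []
... | yes P[] = inj₂ ([] , ≼-refl , P[] , λ q q≼[] _ → subst (_≼ []) (sym (≼-[] q≼[])) ≼-refl)
... | no ¬P[] = inj₁ λ q q≼[] → subst (¬_ ∘ P) (sym (≼-[] q≼[])) ¬P[]
deepest-prefix (i ∷ f) P P? with deepest-prefix f (P ∘ (i ∷_)) (P? ∘ (i ∷_))
... | inj₂ (Q , Q≼f , PQ , max) = inj₂ (i ∷ Q , ∷-≼ Q≼f , PQ , max′)
  where
  max′ : ∀ q → q ≼ (i ∷ f) → P q → q ≼ (i ∷ Q)
  max′ q q≼ Pq with ≼-∷⁻ q≼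
  ... | inj₁ refl = []-≼ _
  ... | inj₂ (q′ , refl , q′≼f) = ∷-≼ (max q′ q′≼f Pq)
... | inj₁ none with P? []
...   | yes P[] = inj₂ ([] , []-≼ _ , P[] , max′)
  where
  max′ : ∀ q → q ≼ (i ∷ f) → P q → q ≼ []
  max′ q q≼ Pq with ≼-∷⁻ q≼
  ... | inj₁ refl = ≼-refl
  ... | inj₂ (q′ , refl , q′≼f) = ⊥-elim (none q′ q′≼f Pq)
...   | no ¬P[] = inj₁ none′
  where
  none′ : ∀ q → q ≼ (i ∷ f) → ¬ P q
  none′ q q≼ Pq with ≼-∷⁻ q≼
  ... | inj₁ refl = ¬P[] Pq
  ... | inj₂ (q′ , refl , q′≼f) = none q′ q′≼f Pq

-- Subterms, replacement and substitution

module _ {F : Set} {ar : F → ℕ} where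

  mutual
    ∣-++ : ∀ u q r {w} → u ∣ q ≡ just w → u ∣ (q ++ r) ≡ w ∣ r
    ∣-++ u [] r refl = refl
    ∣-++ (var x) (i ∷ q) r ()
    ∣-++ (fun f ts) (i ∷ q) r h = subArgs-++ ts i q r h

    subArgs-++ : ∀ {n} (ts : Vec (Term ar) n) i q r {w} → subArgs ts i q ≡ just w →
      subArgs ts i (q ++ r) ≡ w ∣ r
    subArgs-++ [] i q r ()
    subArgs-++ (t ∷ ts) zero q r h = ∣-++ t q r h
    subArgs-++ (t ∷ ts) (suc i) q r h = subArgs-++ ts i q r h

  mutual
    replace-∣-inside : ∀ u p r v {w} → u ∣ p ≡ just w → replace u p v ∣ (p ++ r) ≡ v ∣ r
    replace-∣-inside u [] r v h = refl
    replace-∣-inside (var x) (i ∷ p) r v ()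
    replace-∣-inside (fun f ts) (i ∷ p) r v h = replaceArgs-subArgs-inside ts i p r v h

    replaceArgs-subArgs-inside : ∀ {n} (ts : Vec (Term ar) n) i p r v {w} → subArgs ts i p ≡ just w →
      subArgs (replaceArgs ts i p v) i (p ++ r) ≡ v ∣ r
    replaceArgs-subArgs-inside [] i p r v ()
    replaceArgs-subArgs-inside (t ∷ ts) zero p r v h = replace-∣-inside t p r v h
    replaceArgs-subArgs-inside (t ∷ ts) (suc i) p r v h = replaceArgs-subArgs-inside ts i p r v h

  mutual
    replace-∣-∥ : ∀ u {p q} v → p ∥ q → replace u p v ∣ q ≡ u ∣ q
    replace-∣-∥ u {[]} {q} v (p⋠q , _) = ⊥-elim (p⋠q ([]-≼ q))
    replace-∣-∥ u {i ∷ p} {[]} v (_ , q⋠p) = ⊥-elim (q⋠p ([]-≼ _))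
    replace-∣-∥ (var x) {i ∷ p} {j ∷ q} v _ = refl
    replace-∣-∥ (fun f ts) {i ∷ p} {j ∷ q} v p∥q = replaceArgs-subArgs-∥ ts v λ { refl → ∷-∥ p∥q }

    replaceArgs-subArgs-∥ : ∀ {n} (ts : Vec (Term ar) n) {i j p q} v → (i ≡ j → p ∥ q) →
      subArgs (replaceArgs ts i p v) j q ≡ subArgs ts j q
    replaceArgs-subArgs-∥ [] v _ = refl
    replaceArgs-subArgs-∥ (t ∷ ts) {zero} {zero} v p∥q = replace-∣-∥ t v (p∥q refl)
    replaceArgs-subArgs-∥ (t ∷ ts) {zero} {suc j} v _ = refl
    replaceArgs-subArgs-∥ (t ∷ ts) {suc i} {zero} v _ = refl
    replaceArgs-subArgs-∥ (t ∷ ts) {suc i} {suc j} v p∥q = replaceArgs-subArgs-∥ ts v (p∥q ∘ cong suc)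

  mutual
    replace-comm : ∀ u {p q} a b → p ∥ q → replace (replace u p a) q b ≡ replace (replace u q b) p a
    replace-comm u {[]} {q} a b (p⋠q , _) = ⊥-elim (p⋠q ([]-≼ q))
    replace-comm u {i ∷ p} {[]} a b (_ , q⋠p) = ⊥-elim (q⋠p ([]-≼ _))
    replace-comm (var x) {i ∷ p} {j ∷ q} a b _ = refl
    replace-comm (fun f ts) {i ∷ p} {j ∷ q} a b p∥q =
      cong (fun f) (replaceArgs-comm ts a b λ { refl → ∷-∥ p∥q })

    replaceArgs-comm : ∀ {n} (ts : Vec (Term ar) n) {i j p q} a b → (i ≡ j → p ∥ q) →
      replaceArgs (replaceArgs ts i p a) j q b ≡ replaceArgs (replaceArgs ts j q b) i p a
    replaceArgs-comm [] a b _ = refl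
    replaceArgs-comm (t ∷ ts) {zero} {zero} a b p∥q = cong (_∷ ts) (replace-comm t a b (p∥q refl))
    replaceArgs-comm (t ∷ ts) {zero} {suc j} a b _ = refl
    replaceArgs-comm (t ∷ ts) {suc i} {zero} a b _ = refl
    replaceArgs-comm (t ∷ ts) {suc i} {suc j} a b p∥q =
      cong (t ∷_) (replaceArgs-comm ts a b (p∥q ∘ cong suc))

  mutual
    ⋅-∣ : ∀ t s σ {v} → t ∣ s ≡ just v → (t ⋅ σ) ∣ s ≡ just (v ⋅ σ)
    ⋅-∣ t [] σ refl = refl
    ⋅-∣ (var x) (i ∷ s) σ ()
    ⋅-∣ (fun f ts) (i ∷ s) σ h = substArgs-subArgs ts i s σ h

    substArgs-subArgs : ∀ {n} (ts : Vec (Term ar) n) i s σ {v} → subArgs ts i s ≡ just v →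
      subArgs (substArgs ts σ) i s ≡ just (v ⋅ σ)
    substArgs-subArgs [] i s σ ()
    substArgs-subArgs (t ∷ ts) zero s σ h = ⋅-∣ t s σ h
    substArgs-subArgs (t ∷ ts) (suc i) s σ h = substArgs-subArgs ts i s σ h

  mutual
    ∣-⋅⁻ : ∀ t s σ {w} → (t ⋅ σ) ∣ s ≡ just w →
      ∃[ g ] ∃[ ts ] ∃[ ts′ ] (t ∣ s ≡ just (fun g ts) × w ≡ fun g ts′)
      ⊎ ∃[ s₁ ] ∃[ s₂ ] ∃[ x ] (s ≡ s₁ ++ s₂ × t ∣ s₁ ≡ just (var x) × σ x ∣ s₂ ≡ just w)
    ∣-⋅⁻ (var x) s σ h = inj₂ ([] , s , x , refl , refl , h)
    ∣-⋅⁻ (fun f ts) [] σ refl = inj₁ (f , ts , substArgs ts σ , refl , refl)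
    ∣-⋅⁻ (fun f ts) (i ∷ s) σ h with substArgs-subArgs⁻ ts i s σ h
    ... | inj₁ at-fun = inj₁ at-fun
    ... | inj₂ (s₁ , s₂ , x , refl , at-x , inside) = inj₂ (i ∷ s₁ , s₂ , x , refl , at-x , inside)

    substArgs-subArgs⁻ : ∀ {n} (ts : Vec (Term ar) n) i s σ {w} → subArgs (substArgs ts σ) i s ≡ just w →
      ∃[ g ] ∃[ us ] ∃[ us′ ] (subArgs ts i s ≡ just (fun g us) × w ≡ fun g us′)
      ⊎ ∃[ s₁ ] ∃[ s₂ ] ∃[ x ] (s ≡ s₁ ++ s₂ × subArgs ts i s₁ ≡ just (var x) × σ x ∣ s₂ ≡ just w)
    substArgs-subArgs⁻ [] i s σ ()
    substArgs-subArgs⁻ (t ∷ ts) zero s σ h = ∣-⋅⁻ t s σ h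
    substArgs-subArgs⁻ (t ∷ ts) (suc i) s σ h = substArgs-subArgs⁻ ts i s σ h

  mutual
    ∣-var⇒∈vars : ∀ t s {x} → t ∣ s ≡ just (var x) → x ∈ vars t
    ∣-var⇒∈vars t [] refl = here refl
    ∣-var⇒∈vars (var y) (i ∷ s) ()
    ∣-var⇒∈vars (fun f ts) (i ∷ s) h = subArgs-var⇒∈varsArgs ts i s h

    subArgs-var⇒∈varsArgs : ∀ {n} (ts : Vec (Term ar) n) i s {x} → subArgs ts i s ≡ just (var x) →
      x ∈ varsArgs ts
    subArgs-var⇒∈varsArgs [] i s ()
    subArgs-var⇒∈varsArgs (t ∷ ts) zero s h = ∈-++⁺ˡ (∣-var⇒∈vars t s h)
    subArgs-var⇒∈varsArgs (t ∷ ts) (suc i) s h = ∈-++⁺ʳ (vars t) (subArgs-var⇒∈varsArgs ts i s h)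

  mutual
    ∈vars⇒∣-var : ∀ t {x} → x ∈ vars t → ∃[ s ] (t ∣ s ≡ just (var x))
    ∈vars⇒∣-var (var y) (here refl) = [] , refl
    ∈vars⇒∣-var (fun f ts) x∈ts with ∈varsArgs⇒subArgs-var ts x∈ts
    ... | i , s , at-x = i ∷ s , at-x

    ∈varsArgs⇒subArgs-var : ∀ {n} (ts : Vec (Term ar) n) {x} → x ∈ varsArgs ts →
      ∃[ i ] ∃[ s ] (subArgs ts i s ≡ just (var x))
    ∈varsArgs⇒subArgs-var (t ∷ ts) x∈ with ∈-++⁻ (vars t) x∈
    ... | inj₁ x∈t = let s , at-x = ∈vars⇒∣-var t x∈t in zero , s , at-x
    ... | inj₂ x∈ts = let i , s , at-x = ∈varsArgs⇒subArgs-var ts x∈ts in suc i , s , at-x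

module _ {A B : Set} (g : A → List B) where

  ∈-concatMap-take⁻ : ∀ (cs : List A) m {x} → x ∈ concatMap g (take m cs) →
    ∃[ i ] (toℕ {length cs} i < m × x ∈ g (lookup cs i))
  ∈-concatMap-take⁻ [] zero ()
  ∈-concatMap-take⁻ [] (suc m) ()
  ∈-concatMap-take⁻ (c ∷ cs) zero ()
  ∈-concatMap-take⁻ (c ∷ cs) (suc m) x∈ with ∈-++⁻ (g c) x∈
  ... | inj₁ x∈c = Fin.zero , s≤s z≤n , x∈c
  ... | inj₂ x∈cs = let i , i<m , x∈ci = ∈-concatMap-take⁻ cs m x∈cs in Fin.suc i , s≤s i<m , x∈ci

  ∈-concatMap-take⁺ : ∀ (cs : List A) m (i : Fin (length cs)) {x} → toℕ i < m → x ∈ g (lookup cs i) →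
    x ∈ concatMap g (take m cs)
  ∈-concatMap-take⁺ (c ∷ cs) (suc m) Fin.zero _ x∈c = ∈-++⁺ˡ x∈c
  ∈-concatMap-take⁺ (c ∷ cs) (suc m) (Fin.suc i) (s≤s i<m) x∈ci =
    ∈-++⁺ʳ (g c) (∈-concatMap-take⁺ cs m i i<m x∈ci)

-- The unraveled system U_seq(R)

module UseqProperties {F : Set} (arF : F → ℕ) {I : Set} (R : I → CRule arF) where
  open Unravel arF R

  UTermAt : T → Pos → Set
  UTermAt u q = ∃[ w ] (u ∣ q ≡ just w × IsUTerm w)

  uTermAt? : ∀ u q → Dec (UTermAt u q)
  uTermAt? u q with u ∣ q
  ... | nothing = no λ { (_ , () , _) }
  ... | just (var x) = no λ { (_ , refl , ()) }
  ... | just (fun (inj₁ f) ts) = no λ { (_ , refl , ()) }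
  ... | just (fun (inj₂ αj) ts) = yes (_ , refl , tt)

  has-UTerm⇒has-arg : ∀ u s {w} → u ∣ s ≡ just w → IsUTerm w → ∃[ a ] (u ∣ (0 ∷ []) ≡ just a)
  has-UTerm⇒has-arg (var x) [] refl ()
  has-UTerm⇒has-arg (fun (inj₁ f) ts) [] refl ()
  has-UTerm⇒has-arg (fun (inj₂ αj) (a ∷ ts)) [] refl _ = a , refl
  has-UTerm⇒has-arg (var x) (i ∷ s) ()
  has-UTerm⇒has-arg (fun g ts) (i ∷ s) h _ = nonempty ts h
    where
    nonempty : ∀ {n} (ts : Vec T n) {w} → subArgs ts i s ≡ just w → ∃[ a ] (subArgs ts 0 [] ≡ just a)
    nonempty (a ∷ _) _ = a , refl

  mutual
    lift-noUTerm : ∀ t s {w} → lift t ∣ s ≡ just w → ¬ IsUTerm w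
    lift-noUTerm (var x) [] refl ()
    lift-noUTerm (fun f ts) [] refl ()
    lift-noUTerm (var x) (i ∷ s) ()
    lift-noUTerm (fun f ts) (i ∷ s) h = liftArgs-noUTerm ts i s h

    liftArgs-noUTerm : ∀ {n} (ts : Vec (Term arF) n) i s {w} → subArgs (liftArgs ts) i s ≡ just w →
      ¬ IsUTerm w
    liftArgs-noUTerm [] i s ()
    liftArgs-noUTerm (t ∷ ts) zero s h = lift-noUTerm t s h
    liftArgs-noUTerm (t ∷ ts) (suc i) s h = liftArgs-noUTerm ts i s h

  map-var-noUTerm : ∀ xs i s {w} → subArgs (V.map {B = T} var (fromList xs)) i s ≡ just w → ¬ IsUTerm w
  map-var-noUTerm [] i s ()
  map-var-noUTerm (x ∷ xs) zero [] refl ()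
  map-var-noUTerm (x ∷ xs) zero (j ∷ s) ()
  map-var-noUTerm (x ∷ xs) (suc i) s h = map-var-noUTerm xs i s h

  Uterm-lift-UTerm⇒root : ∀ α j a s {w} → Uterm α j (lift a) ∣ s ≡ just w → IsUTerm w → s ≡ []
  Uterm-lift-UTerm⇒root α j a [] _ _ = refl
  Uterm-lift-UTerm⇒root α j a (zero ∷ s) h isU = ⊥-elim (lift-noUTerm a s h isU)
  Uterm-lift-UTerm⇒root α j a (suc i ∷ s) h isU = ⊥-elim (map-var-noUTerm (X α j) i s h isU)

  rhs-UTerm⇒root : ∀ {l r} → UseqRule l r → ∀ s {w} → r ∣ s ≡ just w → IsUTerm w → s ≡ []
  rhs-UTerm⇒root (uncond α _) s h isU = ⊥-elim (lift-noUTerm _ s h isU)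
  rhs-UTerm⇒root (first α j _) s h isU = Uterm-lift-UTerm⇒root α j _ s h isU
  rhs-UTerm⇒root (middle α j j′ _) s h isU = Uterm-lift-UTerm⇒root α j′ _ s h isU
  rhs-UTerm⇒root (last α j _) s h isU = ⊥-elim (lift-noUTerm _ s h isU)

  mutual
    vars-lift : ∀ t → vars (lift t) ≡ vars t
    vars-lift (var x) = refl
    vars-lift (fun f ts) = varsArgs-liftArgs ts

    varsArgs-liftArgs : ∀ {n} (ts : Vec (Term arF) n) → varsArgs (liftArgs ts) ≡ varsArgs ts
    varsArgs-liftArgs [] = refl
    varsArgs-liftArgs (t ∷ ts) = cong₂ _++_ (vars-lift t) (varsArgs-liftArgs ts)

  ∈-lift⁻ : ∀ t {x} → x ∈ vars (lift t) → x ∈ vars t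
  ∈-lift⁻ t {x} = subst (x ∈_) (vars-lift t)

  ∈-lift⁺ : ∀ t {x} → x ∈ vars t → x ∈ vars (lift t)
  ∈-lift⁺ t {x} = subst (x ∈_) (sym (vars-lift t))

  varsArgs-map-var : ∀ xs → varsArgs (V.map {B = T} var (fromList xs)) ≡ xs
  varsArgs-map-var [] = refl
  varsArgs-map-var (x ∷ xs) = cong (x ∷_) (varsArgs-map-var xs)

  ∈-Uterm⁻ : ∀ α j a {x} → x ∈ vars (Uterm α j a) → x ∈ vars a ⊎ x ∈ varsLT (R α) (toℕ j)
  ∈-Uterm⁻ α j a {x} x∈ =
    Sum.map₂ (∈-deduplicate⁻ _≟ℕ_ _ ∘ subst (x ∈_) (varsArgs-map-var (X α j))) (∈-++⁻ (vars a) x∈)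

  ∈-Uterm⁺ : ∀ α j a {x} → x ∈ vars a ⊎ x ∈ varsLT (R α) (toℕ j) → x ∈ vars (Uterm α j a)
  ∈-Uterm⁺ α j a (inj₁ x∈a) = ∈-++⁺ˡ x∈a
  ∈-Uterm⁺ α j a {x} (inj₂ x∈X) =
    ∈-++⁺ʳ (vars a) (subst (x ∈_) (sym (varsArgs-map-var (X α j))) (∈-deduplicate⁺ _≟ℕ_ x∈X))

  ∈-varsLT⁻ : ∀ α m {x} → x ∈ varsLT (R α) m →
    x ∈ vars (lhs (R α)) ⊎ ∃[ i ] (toℕ i < m × x ∈ vars (t α i))
  ∈-varsLT⁻ α m x∈ =
    Sum.map₂ (∈-concatMap-take⁻ (vars ∘ proj₂) (conds (R α)) m) (∈-++⁻ (vars (lhs (R α))) x∈)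

  ∈-varsLT⁺ : ∀ α {m} i {x} → toℕ i < m → x ∈ vars (t α i) → x ∈ varsLT (R α) m
  ∈-varsLT⁺ α {m} i i<m x∈ =
    ∈-++⁺ʳ (vars (lhs (R α))) (∈-concatMap-take⁺ (vars ∘ proj₂) (conds (R α)) m i i<m x∈)

  varsLT-mono : ∀ α {m n x} → m ≤ n → x ∈ varsLT (R α) m → x ∈ varsLT (R α) n
  varsLT-mono α {m} m≤n x∈ with ∈-varsLT⁻ α m x∈
  ... | inj₁ x∈l = ∈-++⁺ˡ x∈l
  ... | inj₂ (i , i<m , x∈t) = ∈-varsLT⁺ α i (<-≤-trans i<m m≤n) x∈t

  varsLT-zero : ∀ α {m x} → m ≡ 0 → x ∈ varsLT (R α) m → x ∈ vars (lhs (R α))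
  varsLT-zero α refl x∈ with ∈-varsLT⁻ α 0 x∈
  ... | inj₁ x∈l = x∈l

  varsLT-suc : ∀ α j {x} → x ∈ varsLT (R α) (suc (toℕ j)) → x ∈ vars (t α j) ⊎ x ∈ varsLT (R α) (toℕ j)
  varsLT-suc α j x∈ with ∈-varsLT⁻ α _ x∈
  ... | inj₁ x∈l = inj₂ (∈-++⁺ˡ x∈l)
  ... | inj₂ (i , i<1+j , x∈t) with m<1+n⇒m<n∨m≡n i<1+j
  ...   | inj₁ i<j = inj₂ (∈-varsLT⁺ α i i<j x∈t)
  ...   | inj₂ i≡j = inj₁ (subst (λ i → _ ∈ vars (t α i)) (toℕ-injective i≡j) x∈t)

  Innermost : T → Set
  Innermost w = ∀ q w′ → ¬ q ≡ [] → w ∣ q ≡ just w′ → ¬ Redex w′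

  NormalAt : T → Pos → Set
  NormalAt u q = ∀ r {w} → u ∣ (q ++ r) ≡ just w → ¬ Redex w

  -- A variable left-hand side makes every term a redex, so an innermost redex then has no
  -- argument at all, whereas a term containing a U-term has one.
  innermost-var-normal : ∀ {l r σ x} s {w} → UseqRule l r → Innermost (l ⋅ σ) → x ∈ vars l →
    σ x ∣ s ≡ just w → IsUTerm w → NormalAt (σ x) s
  innermost-var-normal {l} {r} {σ} {x} s ρ inner x∈l at-w isU with ∈vars⇒∣-var l x∈l
  ... | [] , refl with has-UTerm⇒has-arg (σ x) s at-w isU
  ...   | a , at-a = ⊥-elim (inner (0 ∷ []) a (λ ()) at-a (var x , r , (λ _ → a) , ρ , refl))
  innermost-var-normal {l} {r} {σ} {x} s ρ inner x∈l at-w isU | i ∷ s′ , at-x = λ r′ at →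
    inner (i ∷ s′ ++ s ++ r′) _ (λ ()) (trans (∣-++ (l ⋅ σ) (i ∷ s′) (s ++ r′) (⋅-∣ l (i ∷ s′) σ at-x)) at)

  -- Reordering innermost derivations

  data Derivation : T → List Pos → T → Set where
    done : ∀ {u} → Derivation u [] u
    step : ∀ {u p v ps w} → InnermostStep u p v → Derivation v ps w → Derivation u (p ∷ ps) w

  Touched : Pos → List Pos → Set
  Touched q [] = ⊥
  Touched q (p ∷ ps) = q ≼ p ⊎ (q ∥ p × Touched q ps)

  touched? : ∀ q ps → Dec (Touched q ps)
  touched? q [] = no λ ()
  touched? q (p ∷ ps) with q ≼? p
  ... | yes q≼p = yes (inj₁ q≼p)
  ... | no q⋠p with p ≼? q
  ...   | yes p≼q = no λ { (inj₁ q≼p) → q⋠p q≼p ; (inj₂ ((_ , p⋠q) , _)) → p⋠q p≼q }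
  ...   | no p⋠q with touched? q ps
  ...     | yes t = yes (inj₂ ((q⋠p , p⋠q) , t))
  ...     | no ¬t = no λ { (inj₁ q≼p) → q⋠p q≼p ; (inj₂ (_ , t)) → ¬t t }

  Touched-insert : ∀ ps₁ {q p ps₂} → q ∥ p → Touched q (ps₁ ++ ps₂) → Touched q (ps₁ ++ p ∷ ps₂)
  Touched-insert [] q∥p t = inj₂ (q∥p , t)
  Touched-insert (a ∷ ps₁) q∥p (inj₁ q≼a) = inj₁ q≼a
  Touched-insert (a ∷ ps₁) q∥p (inj₂ (q∥a , t)) = inj₂ (q∥a , Touched-insert ps₁ q∥p t)

  Touched-after-∥ : ∀ ps₁ {q p ps₂} → All (q ∥_) ps₁ → q ≼ p → Touched q (ps₁ ++ p ∷ ps₂)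
  Touched-after-∥ [] [] q≼p = inj₁ q≼p
  Touched-after-∥ (a ∷ ps₁) (q∥a ∷ q∥ps₁) q≼p = inj₂ (q∥a , Touched-after-∥ ps₁ q∥ps₁ q≼p)

  first-touch : ∀ {q} ps → Touched q ps →
    ∃[ ps₁ ] ∃[ p ] ∃[ ps₂ ] (ps ≡ ps₁ ++ p ∷ ps₂ × All (q ∥_) ps₁ × q ≼ p)
  first-touch (p ∷ ps) (inj₁ q≼p) = [] , p , ps , refl , [] , q≼p
  first-touch (a ∷ ps) (inj₂ (q∥a , t)) with first-touch ps t
  ... | ps₁ , p , ps₂ , refl , q∥ps₁ , q≼p = a ∷ ps₁ , p , ps₂ , refl , q∥a ∷ q∥ps₁ , q≼p

  normal-untouched : ∀ {u ps w q} → Derivation u ps w → NormalAt u q → ¬ Touched q ps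
  normal-untouched (step ((l , r , σ , ρ , at , refl) , _) _) normal (inj₁ (r₀ , refl)) =
    normal r₀ at (l , r , σ , ρ , refl)
  normal-untouched {u} {q = q} (step {p = p} ((l , r , σ , ρ , _ , refl) , _) D) normal (inj₂ (q∥p , t)) =
    normal-untouched D (λ r₀ → normal r₀ ∘ trans (sym (replace-∣-∥ u (r ⋅ σ) (∥-sym (∥-++ r₀ q∥p))))) t

  swap-∥ : ∀ {u a u₁ p u₂} → a ∥ p → InnermostStep u a u₁ → InnermostStep u₁ p u₂ →
    ∃[ v ] (InnermostStep u p v × InnermostStep v a u₂)
  swap-∥ {u} {a} {p = p} a∥p ((l₁ , r₁ , σ₁ , ρ₁ , at-a , refl) , inner₁)
                             ((l₂ , r₂ , σ₂ , ρ₂ , at-p , refl) , inner₂) =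
    replace u p (r₂ ⋅ σ₂) ,
    ((l₂ , r₂ , σ₂ , ρ₂ , trans (sym p-unchanged) at-p , refl) , λ w → inner₂ w ∘ trans p-unchanged) ,
    ((l₁ , r₁ , σ₁ , ρ₁ , trans a-unchanged at-a , replace-comm u (r₁ ⋅ σ₁) (r₂ ⋅ σ₂) a∥p) ,
     λ w → inner₁ w ∘ trans (sym a-unchanged))
    where
    p-unchanged = replace-∣-∥ u (r₁ ⋅ σ₁) a∥p
    a-unchanged = replace-∣-∥ u (r₂ ⋅ σ₂) (∥-sym a∥p)

  bubble : ∀ ps₁ {u p ps₂ w} → All (_∥ p) ps₁ → Derivation u (ps₁ ++ p ∷ ps₂) w →
    ∃[ u′ ] (InnermostStep u p u′ × Derivation u′ (ps₁ ++ ps₂) w)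
  bubble [] [] (step st D) = _ , st , D
  bubble (a ∷ ps₁) (a∥p ∷ ps₁∥p) (step st₁ D₁) with bubble ps₁ ps₁∥p D₁
  ... | _ , st₂ , D′ with swap-∥ a∥p st₁ st₂
  ...   | v , stp , sta = v , stp , step sta D′

  Pending : T → List Pos → Pos → Set
  Pending u ps q = UTermAt u q × Touched q ps

  pending? : ∀ u ps q → Dec (Pending u ps q)
  pending? u ps q = uTermAt? u q ×-dec touched? q ps

  PendingAbove : T → List Pos → Pos → Set
  PendingAbove u ps f = ∀ q → UTermAt u q → Touched q ps → q ≼ f

  -- f is the position of the step preceding the derivation.
  EagerAfter : ∀ {u ps w} → Pos → Derivation u ps w → Set
  EagerAfter f done = ⊤
  EagerAfter f (step {u} {p} _ D) = (∀ q → UTermAt u q → q ≼ p → q ≼ f) × EagerAfter p D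

  record NextStep (u : T) (ps : List Pos) (f : Pos) : Set where
    field
      before : List Pos
      pos : Pos
      after : List Pos
      split : ps ≡ before ++ pos ∷ after
      before-∥ : All (_∥ pos) before
      pending-≼ : ∀ q → UTermAt u q → Touched q ps → q ≼ pos
      eager : ∀ q → UTermAt u q → q ≼ pos → q ≼ f

  next-step : ∀ {u p₀ ps₀} f → PendingAbove u (p₀ ∷ ps₀) f → NextStep u (p₀ ∷ ps₀) f
  next-step {u} {p₀} {ps₀} f above with deepest-prefix f (Pending u (p₀ ∷ ps₀)) (pending? u (p₀ ∷ ps₀))
  ... | inj₁ none = record
    { before = [] ; pos = p₀ ; after = ps₀ ; split = refl ; before-∥ = []
    ; pending-≼ = λ q U-q t → ⊥-elim (none q (above q U-q t) (U-q , t))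
    ; eager = λ q U-q q≼p₀ → above q U-q (inj₁ q≼p₀) }
  ... | inj₂ (Q , Q≼f , (_ , t-Q) , deepest-Q) with first-touch (p₀ ∷ ps₀) t-Q
  ...   | ps₁ , p , ps₂ , split , Q∥ps₁ , Q≼p = record
    { before = ps₁ ; pos = p ; after = ps₂ ; split = split
    ; before-∥ = All.map (λ Q∥a → ∥-≼ (∥-sym Q∥a) Q≼p) Q∥ps₁
    ; pending-≼ = λ q U-q t → ≼-trans (deepest-Q q (above q U-q t) (U-q , t)) Q≼p
    ; eager = eager }
    where
    eager : ∀ q → UTermAt u q → q ≼ p → q ≼ f
    eager q U-q q≼p with ≼-comparable q≼p Q≼p
    ... | inj₁ q≼Q = ≼-trans q≼Q Q≼f
    ... | inj₂ (r , refl) =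
      above q U-q (subst (Touched q) (sym split) (Touched-after-∥ ps₁ (All.map (∥-++ r) Q∥ps₁) q≼p))

  NextStep-shorter : ∀ {u ps f n} (N : NextStep u ps f) → length ps ≡ suc n →
    length (NextStep.before N ++ NextStep.after N) ≡ n
  NextStep-shorter N len rewrite NextStep.split N =
    suc-injective (trans (sym (length-++-sucʳ (NextStep.before N) (NextStep.pos N) (NextStep.after N))) len)

  fromSequence : ∀ n (us : ℕ → T) ps → InnermostDeriv n us ps → ∃[ qs ] Derivation (us 0) qs (us n)
  fromSequence zero us ps _ = [] , done
  fromSequence (suc n) us ps steps =
    let qs , D = fromSequence n (us ∘ suc) (ps ∘ suc) (λ i i<n → steps (suc i) (s≤s i<n)) in
    ps 0 ∷ qs , step (steps 0 (s≤s z≤n)) D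

  termAt : ∀ {u ps w} → Derivation u ps w → ℕ → T
  termAt {u} done _ = u
  termAt {u} (step _ _) zero = u
  termAt (step _ D) (suc i) = termAt D i

  posAt : ∀ {u ps w} → Derivation u ps w → ℕ → Pos
  posAt done _ = []
  posAt (step {p = p} _ _) zero = p
  posAt (step _ D) (suc i) = posAt D i

  termAt-zero : ∀ {u ps w} (D : Derivation u ps w) → termAt D 0 ≡ u
  termAt-zero done = refl
  termAt-zero (step _ _) = refl

  termAt-length : ∀ {u ps w} (D : Derivation u ps w) → termAt D (length ps) ≡ w
  termAt-length done = refl
  termAt-length (step _ D) = termAt-length D

  termAt-innermost : ∀ {u ps w} (D : Derivation u ps w) → InnermostDeriv (length ps) (termAt D) (posAt D)
  termAt-innermost {u} (step {p = p} st D) zero _ = subst (InnermostStep u p) (sym (termAt-zero D)) st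
  termAt-innermost (step _ D) (suc i) (s≤s i<n) = termAt-innermost D i i<n

  termAt-almostUEager : ∀ {u ps w} f (D : Derivation u ps w) → EagerAfter f D →
    AlmostUEager (length ps) (termAt D) (posAt D)
  termAt-almostUEager f (step _ (step _ _)) (_ , eager , _) zero _ q w at-w isU = eager q (w , at-w , isU)
  termAt-almostUEager f (step {p = p} _ D) (_ , eager) (suc j) (s≤s j<n) =
    termAt-almostUEager p D eager j j<n

  module Deterministic (det : DCTRS R) where

    condVars⊆varsLT : ∀ α {x} → x ∈ condVars (R α) → x ∈ varsLT (R α) (k α)
    condVars⊆varsLT α x∈ with ∈-concatMap⁻ (λ c → vars (proj₁ c) ++ vars (proj₂ c)) {xs = conds (R α)} x∈
    ... | x∈c with ∈-++⁻ (vars (s α (index x∈c))) (lookup-index x∈c)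
    ...   | inj₁ x∈s = varsLT-mono α (<⇒≤ (toℕ<n (index x∈c))) (proj₂ (det α) (index x∈c) _ x∈s)
    ...   | inj₂ x∈t = ∈-varsLT⁺ α (index x∈c) (toℕ<n (index x∈c)) x∈t

    rhs⊆varsLT : ∀ α {x} → x ∈ vars (rhs (R α)) → x ∈ varsLT (R α) (k α)
    rhs⊆varsLT α x∈ = [ ∈-++⁺ˡ , condVars⊆varsLT α ] (proj₁ (det α) _ x∈)

    Uterm-s⊆varsLT : ∀ α j {x} → x ∈ vars (Uterm α j (lift (s α j))) → x ∈ varsLT (R α) (toℕ j)
    Uterm-s⊆varsLT α j x∈ = [ proj₂ (det α) j _ ∘ ∈-lift⁻ (s α j) , id ] (∈-Uterm⁻ α j (lift (s α j)) x∈)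

    varsLT⊆Uterm-t : ∀ α j {x} → x ∈ varsLT (R α) (suc (toℕ j)) → x ∈ vars (Uterm α j (lift (t α j)))
    varsLT⊆Uterm-t α j x∈ = ∈-Uterm⁺ α j (lift (t α j)) (Sum.map₁ (∈-lift⁺ (t α j)) (varsLT-suc α j x∈))

    rhs⊆lhs : ∀ {l r} → UseqRule l r → ∀ {x} → x ∈ vars r → x ∈ vars l
    rhs⊆lhs (uncond α no-conds) x∈ =
      ∈-lift⁺ (lhs (R α)) (varsLT-zero α (cong length no-conds) (rhs⊆varsLT α (∈-lift⁻ (rhs (R α)) x∈)))
    rhs⊆lhs (first α j j≡0) x∈ = ∈-lift⁺ (lhs (R α)) (varsLT-zero α j≡0 (Uterm-s⊆varsLT α j x∈))
    rhs⊆lhs (middle α j j′ j′≡1+j) {x} x∈ =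
      varsLT⊆Uterm-t α j (subst (λ m → x ∈ varsLT (R α) m) j′≡1+j (Uterm-s⊆varsLT α j′ x∈))
    rhs⊆lhs (last α j 1+j≡k) {x} x∈ =
      varsLT⊆Uterm-t α j
        (subst (λ m → x ∈ varsLT (R α) m) (sym 1+j≡k) (rhs⊆varsLT α (∈-lift⁻ (rhs (R α)) x∈)))

    contractum-normal : ∀ {l r σ} s {w} → UseqRule l r → Innermost (l ⋅ σ) → ¬ s ≡ [] →
      (r ⋅ σ) ∣ s ≡ just w → IsUTerm w → NormalAt (r ⋅ σ) s
    contractum-normal {l} {r} {σ} s ρ inner s≢[] at-w isU with ∣-⋅⁻ r s σ at-w
    ... | inj₁ (inj₁ f , _ , _ , _ , refl) = ⊥-elim isU
    ... | inj₁ (inj₂ αj , _ , _ , at-U , refl) = ⊥-elim (s≢[] (rhs-UTerm⇒root ρ s at-U tt))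
    ... | inj₂ (s₁ , s₂ , x , refl , at-x , inside) = λ r′ at →
      innermost-var-normal s₂ ρ inner (rhs⊆lhs ρ (∣-var⇒∈vars r s₁ at-x)) inside isU r′
        (trans (sym (through-x r′)) at)
      where
      through-x : ∀ r′ → (r ⋅ σ) ∣ ((s₁ ++ s₂) ++ r′) ≡ σ x ∣ (s₂ ++ r′)
      through-x r′ =
        trans (cong ((r ⋅ σ) ∣_) (++-assoc s₁ s₂ r′)) (∣-++ (r ⋅ σ) s₁ (s₂ ++ r′) (⋅-∣ r s₁ σ at-x))

    innermostStep-normal-below : ∀ {u p u′} → InnermostStep u p u′ → ∀ i r {w} →
      u′ ∣ (p ++ i ∷ r) ≡ just w → IsUTerm w → NormalAt u′ (p ++ i ∷ r)
    innermostStep-normal-below {u} {p} ((l , r , σ , ρ , at-p , refl) , inner) i r₀ at-w isU r′ at =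
      contractum-normal (i ∷ r₀) ρ (inner (l ⋅ σ) at-p) (λ ()) (trans (sym (inside (i ∷ r₀))) at-w) isU r′
        (trans (sym (inside (i ∷ r₀ ++ r′))) (trans (cong (u′ ∣_) (sym (++-assoc p (i ∷ r₀) r′))) at))
      where
      u′ = replace u p (r ⋅ σ)
      inside : ∀ r″ → u′ ∣ (p ++ r″) ≡ (r ⋅ σ) ∣ r″
      inside r″ = replace-∣-inside u p r″ (r ⋅ σ) at-p

    pendingAbove-step : ∀ {u p u′ ps w} → InnermostStep u p u′ → Derivation u′ ps w →
      (∀ q → q ∥ p → UTermAt u q → Touched q ps → q ≼ p) → PendingAbove u′ ps p
    pendingAbove-step {u} {p} st D ∥-pending q U-q t with q ≼? p
    ... | yes q≼p = q≼p
    ... | no q⋠p with p ≼? q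
    ...   | yes p≼q with ⋠-≼⇒strictly-below q⋠p p≼q
    ...     | i , r₀ , refl = let _ , at-w , isU = U-q in
                              ⊥-elim (normal-untouched D (innermostStep-normal-below st i r₀ at-w isU) t)
    pendingAbove-step {u} {p} ((l , r , σ , ρ , _ , refl) , _) D ∥-pending q (w , at-w , isU) t
      | no q⋠p | no p⋠q =
      ∥-pending q (q⋠p , p⋠q) (w , trans (sym (replace-∣-∥ u (r ⋅ σ) (p⋠q , q⋠p))) at-w , isU) t

    advance : ∀ {u ps w f} (N : NextStep u ps f) → Derivation u ps w → let open NextStep N in
      ∃[ u′ ] (InnermostStep u pos u′ × Derivation u′ (before ++ after) w ×
               PendingAbove u′ (before ++ after) pos)
    advance {u} {w = w} N D =
      let u′ , st , D′ = bubble before before-∥ (subst (λ ps → Derivation u ps w) split D) in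
      u′ , st , D′ , pendingAbove-step st D′ λ q q∥p U-q t →
        pending-≼ q U-q (subst (Touched q) (sym split) (Touched-insert before q∥p t))
      where open NextStep N

    reorder : ∀ {u ps w} → Derivation u ps w → ∀ f → PendingAbove u ps f →
      ∃[ ps′ ] Σ (Derivation u ps′ w) (EagerAfter f)
    reorder D = go _ refl D
      where
      go : ∀ n {u ps w} → length ps ≡ n → Derivation u ps w → ∀ f → PendingAbove u ps f →
        ∃[ ps′ ] Σ (Derivation u ps′ w) (EagerAfter f)
      go _ _ done _ _ = [] , done , tt
      go zero () (step _ _) _ _
      go (suc n) len D@(step _ _) f above with next-step f above
      ... | N with advance N D
      ...   | _ , st , D′ , above′ with go n (NextStep-shorter N len) D′ (NextStep.pos N) above′
      ...     | ps′ , D″ , eager′ = NextStep.pos N ∷ ps′ , step st D″ , NextStep.eager N , eager′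

lemma12 : {F : Set} (arF : F → ℕ) {I : Set} (R : I → CRule arF) → DCTRS R →
    let open Unravel arF R in
    (n : ℕ) (us : ℕ → T) (ps : ℕ → Pos) →
    InnermostDeriv n us ps → (∃[ t₀ ] (us 0 ≡ lift t₀)) →
    ∃[ m ] ∃[ us′ ] ∃[ ps′ ]
    (InnermostDeriv m us′ ps′ × AlmostUEager m us′ ps′ × us′ 0 ≡ us 0 × us′ m ≡ us n)
lemma12 arF R det n us ps steps (t₀ , us₀≡lift) =
  let _ , D = fromSequence n us ps steps
      qs′ , D′ , eager = reorder D [] no-UTerm
  in length qs′ , termAt D′ , posAt D′ ,
     termAt-innermost D′ , termAt-almostUEager [] D′ eager , termAt-zero D′ , termAt-length D′
  where
  open UseqProperties arF R
  open Deterministic det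
  no-UTerm : ∀ {qs} → PendingAbove (us 0) qs []
  no-UTerm q (_ , at-w , isU) _ = ⊥-elim (lift-noUTerm t₀ q (subst (λ u → u ∣ q ≡ _) us₀≡lift at-w) isU)
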